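{- Let $(\mathcal{C},\mathcal{K})$ be a proximity domain on $U$ and let $\mathcal{H}\subseteq\mathcal{C}\setminus\{\emptyset\}$ with $U\in\mathcal{H}$. Then $\mathcal{H}$ is a system of islands corresponding to $(\mathcal{C},\mathcal{K})$ if and only if $\mathcal{H}$ is a distant family. Moreover, in this case $\mathcal{H}$ is the system of islands corresponding to $(\mathcal{C},\mathcal{K},h)$ where $h$ is the standard height function of $\mathcal{H}$.
   Context: An island domain is a pair $(\mathcal{C},\mathcal{K})$ where $U$ is a nonempty finite set and $\mathcal{C}\subseteq\mathcal{K}\subseteq\mathcal{P}(U)$ with $U\in\mathcal{C}$. It is connective if for all $A,B\in\mathcal{C}$ with $A\cap B\neq\emptyset$ and $B\not\subseteq A$ there exists $K\in\mathcal{K}$ with $A\subsetneq K\subseteq A\cup B$. Let $\prec$ denote the cover relation of $(\mathcal{K},\subseteq)$ and write $A\preceq K$ if $A\prec K$ or $A=K$. Define $\delta$ on $\mathcal{C}$ by $A\,\delta\,B$ iff there is $K\in\mathcal{K}$ with $A\preceq K$ and $K\cap B\neq\emptyset$. A proximity domain is a connective island domain such that for all nonempty $A,B\in\mathcal{C}$, $A\,\delta\,B\iff B\,\delta\,A$. $A,B\in\mathcal{C}$ are distant if neither $A\,\delta\,B$ nor $B\,\delta\,A$; a nonempty family $\mathcal{H}\subseteq\mathcal{C}$ is distant if any two incomparable members of it are distant. A height function is any map $h\colon U\to\mathbb{R}$. A nonempty $S\in\mathcal{C}$ is an island with respect to $(\mathcal{C},\mathcal{K},h)$ if for every $K\in\mathcal{K}$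 with $S\prec K$ and every $u\in K\setminus S$ we have $h(u)<\min h(S)$. The system of islands corresponding to $(\mathcal{C},\mathcal{K},h)$ is the set of all nonempty $S\in\mathcal{C}$ that are islands w.r.t. $(\mathcal{C},\mathcal{K},h)$; a system of islands corresponding to $(\mathcal{C},\mathcal{K})$ is such a set for some $h$. For a family $\mathcal{H}$ whose members are pairwise comparable or disjoint, its standard height function assigns to each $u\in U$ the number of members of $\mathcal{H}$ containing $u$, minus one. -}

module Defs where

open import Level using (Level; _⊔_)
open import Data.Nat using (ℕ; zero; suc; _+_)
open import Data.Integer using (ℤ; +_; _-_)
open import Data.Bool using (Bool; true; false; T; _∧_; if_then_else_)
open import Data.Fin using (Fin)
open import Data.Vec using (Vec; []; _∷_; lookup)
open import Data.List using (List; []; _∷_; map; _++_)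
open import Data.Nat.ListAction using (sum)
open import Data.Fin.Subset using (Subset; _∈_; _∉_; _⊆_; _⊂_; _∩_; _∪_; Nonempty) renaming (⊤ to Uset)
open import Data.Product using (Σ; ∃; _×_; _,_)
open import Data.Sum using (_⊎_)
open import Relation.Nullary using (¬_)
open import Relation.Binary.PropositionalEquality using (_≡_)
open import Relation.Binary.Bundles using (StrictTotalOrder)

-- The ground set U is Fin n; subsets of U are Data.Fin.Subset.Subset n.
-- A family of subsets of U (an element of P(P(U))) is a Boolean-valued
-- characteristic function on Subset n.
Family : ℕ → Set
Family n = Subset n → Bool

_∈F_ : ∀ {n} → Subset n → Family n → Set
S ∈F 𝓗 = T (𝓗 S)

module _ {n : ℕ} (𝓒 𝓚 : Family n) where

  -- (𝓒, 𝓚) is an island domain: 𝓒 ⊆ 𝓚 and U ∈ 𝓒   (U nonempty is n > 0)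
  IsIslandDomain : Set
  IsIslandDomain = (∀ S → S ∈F 𝓒 → S ∈F 𝓚) × (Uset ∈F 𝓒)

  Connective : Set
  Connective = ∀ A B → A ∈F 𝓒 → B ∈F 𝓒 → Nonempty (A ∩ B) → ¬ (B ⊆ A) →
               ∃ λ K → K ∈F 𝓚 × A ⊂ K × K ⊆ (A ∪ B)

  _≺_ : Subset n → Subset n → Set
  A ≺ K = A ∈F 𝓚 × K ∈F 𝓚 × A ⊂ K ×
          (∀ M → M ∈F 𝓚 → ¬ (A ⊂ M × M ⊂ K))

  _⪯_ : Subset n → Subset n → Set
  A ⪯ K = A ≺ K ⊎ A ≡ K

  _δ_ : Subset n → Subset n → Set
  A δ B = ∃ λ K → K ∈F 𝓚 × A ⪯ K × Nonempty (K ∩ B)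

  IsProximityDomain : Set
  IsProximityDomain = IsIslandDomain × Connective ×
    (∀ A B → A ∈F 𝓒 → B ∈F 𝓒 → Nonempty A → Nonempty B →
       ((A δ B → B δ A) × (B δ A → A δ B)))

  Distant : Subset n → Subset n → Set
  Distant A B = ¬ (A δ B) × ¬ (B δ A)

  IsDistantFamily : Family n → Set
  IsDistantFamily 𝓗 = (∀ S → S ∈F 𝓗 → S ∈F 𝓒) × (∃ λ S → S ∈F 𝓗) ×
    (∀ A B → A ∈F 𝓗 → B ∈F 𝓗 → ¬ (A ⊆ B) → ¬ (B ⊆ A) → Distant A B)

  module _ {a ℓ₁ ℓ₂ : Level} (O : StrictTotalOrder a ℓ₁ ℓ₂) where
    open StrictTotalOrder O renaming (Carrier to R)

    -- S is an island w.r.t. (𝓒, 𝓚, h):  S nonempty, S ∈ 𝓒, and for every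
    -- K ∈ 𝓚 with S ≺ K and every u ∈ K ∖ S, h u < min h(S)
    -- (the latter written as: h u < h v for every v ∈ S).
    IsIsland : (Fin n → R) → Subset n → Set (ℓ₂)
    IsIsland h S = Nonempty S × S ∈F 𝓒 ×
      (∀ K → S ≺ K → ∀ u → u ∈ K → u ∉ S → ∀ v → v ∈ S → h u < h v)

    IsSystemOfIslandsFor : (Fin n → R) → Family n → Set ℓ₂
    IsSystemOfIslandsFor h 𝓗 =
      ∀ S → (S ∈F 𝓗 → IsIsland h S) × (IsIsland h S → S ∈F 𝓗)

    IsSystemOfIslands : Family n → Set (a ⊔ ℓ₂)
    IsSystemOfIslands 𝓗 = Σ (Fin n → R) λ h → IsSystemOfIslandsFor h 𝓗

allSubsets : (n : ℕ) → List (Subset n)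
allSubsets zero = [] ∷ []
allSubsets (suc n) = map (false ∷_) (allSubsets n) ++ map (true ∷_) (allSubsets n)

standardHeight : ∀ {n} → Family n → Fin n → ℤ
standardHeight {n} 𝓗 u =
  + sum (map (λ S → if 𝓗 S ∧ lookup S u then 1 else 0) (allSubsets n)) - + 1

module Submission where

-- Everything rests on escaping along a cover: write A ↝ u when u lies in
-- some cover K ≻ A but not in A.  In a connective domain, if A, B ∈ 𝓒 meet
-- and B ⊈ A, then A ↝ u for some u ∈ B (connectiveEscape).
--
-- (⇒) For any height h, incomparable islands A, B can never reach into each
-- other (that would give h u < h w < h u).  So they are disjoint (by
-- escaping), and then not δ-related: δ-witnesses from A to B and, by
-- symmetry of δ, from B to A are such mutual reaches.
--
-- (⇐ and "moreover"; connectivity suffices) Let c x be the number of members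
-- of 𝓗 containing x, so the standard height is c - 1.  If A ∈ 𝓗 and A ↝ u,
-- distance forces every member containing u to contain A, hence c u < c v
-- for all v ∈ A: members are islands.  For an island S pick v ∈ S of least
-- count and the least member G ∋ v (members are laminar), whose points all
-- have count ≥ c v.  Escaping from S into G contradicts the island property
-- of S, escaping from G into S contradicts the choice of v; so S = G ∈ 𝓗.

open import Defs hiding (_≺_; _δ_)
open import Level using (Level)
open import Data.Nat using (ℕ; suc; _<_; _≤_; z≤n; s≤s)
open import Data.Nat.Properties using (≤-reflexive; <⇒≱; ≰⇒>; +-mono-≤; +-mono-<-≤; +-mono-≤-<; ≤-totalOrder)
open import Data.Integer using (ℤ; +_; -_; +≤+; +<+) renaming (_<_ to _<ℤ_)
import Data.Integer.Properties as ℤP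
open import Data.Bool using (true; false; T?; _∧_; if_then_else_)
open import Data.Fin using (Fin)
open import Data.Fin.Subset using (Subset; Nonempty; _∈_; _∉_; _⊆_; _⊈_; _⊂_; _∩_; ∣_∣) renaming (⊤ to Uset)
open import Data.Fin.Subset.Properties using (_∈?_; _⊆?_; _⊂?_; x∈p∩q⁺; x∈p∩q⁻; x∈p∪q⁻; ⊆-trans; ⊆-antisym; p⊂q⇒∣p∣<∣q∣; ∈⊤)
open import Data.Vec using ([]; _∷_; lookup)
open import Data.Vec.Properties using ([]=⇒lookup; lookup⇒[]=)
open import Data.List using (List; []; _∷_; map; filter; allFin)
open import Data.List.Extrema ≤-totalOrder using (argmin; argmin-all; f[argmin]≤f[xs])
open import Data.List.Membership.Propositional using () renaming (_∈_ to _∈ᴸ_)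
open import Data.List.Membership.Propositional.Properties using (∈-++⁺ˡ; ∈-++⁺ʳ; ∈-map⁺; ∈-allFin; ∈-filter⁺)
open import Data.List.Relation.Unary.Any using (here; there)
import Data.List.Relation.Unary.All as All
open import Data.List.Relation.Unary.All.Properties using (all-filter)
open import Data.Nat.ListAction using (sum)
open import Data.Product using (∃; _×_; _,_; proj₁; proj₂)
open import Data.Sum using (_⊎_; inj₁; inj₂)
open import Data.Empty using (⊥; ⊥-elim)
open import Data.Unit using (tt)
open import Function using (_∘_)
open import Relation.Nullary using (¬_; yes; no)
open import Relation.Nullary.Decidable using (_×-dec_; decidable-stable)
open import Relation.Unary using (Decidable)
open import Relation.Binary.Bundles using (StrictTotalOrder)
open import Relation.Binary.Definitions using (tri<; tri≈; tri>)
open import Relation.Binary.PropositionalEquality using (_≡_; refl; sym; trans; subst)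

allSubsets-complete : ∀ {n} (S : Subset n) → S ∈ᴸ allSubsets n
allSubsets-complete [] = here refl
allSubsets-complete {suc n} (false ∷ S) =
  ∈-++⁺ˡ (∈-map⁺ (false ∷_) (allSubsets-complete S))
allSubsets-complete {suc n} (true ∷ S) =
  ∈-++⁺ʳ (map (false ∷_) (allSubsets n)) (∈-map⁺ (true ∷_) (allSubsets-complete S))

minimiser : ∀ {A : Set} {P : A → Set} → Decidable P → (f : A → ℕ) →
            (xs : List A) → (∀ x → x ∈ᴸ xs) → ∃ P →
            ∃ λ m → P m × (∀ x → P x → f m ≤ f x)
minimiser {A} P? f xs complete (x₀ , Px₀) =
  m , argmin-all f Px₀ (all-filter P? xs) ,
  λ x Px → All.lookup (f[argmin]≤f[xs] x₀ candidates) (∈-filter⁺ P? (complete x) Px)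
  where
  candidates : List A
  candidates = filter P? xs
  m : A
  m = argmin f x₀ candidates

sum-mono : ∀ {A : Set} {f g : A → ℕ} → (∀ x → f x ≤ g x) →
           ∀ xs → sum (map f xs) ≤ sum (map g xs)
sum-mono f≤g []       = z≤n
sum-mono f≤g (x ∷ xs) = +-mono-≤ (f≤g x) (sum-mono f≤g xs)

sum-strict : ∀ {A : Set} {f g : A → ℕ} {y : A} {xs : List A} →
             (∀ x → f x ≤ g x) → y ∈ᴸ xs → f y < g y →
             sum (map f xs) < sum (map g xs)
sum-strict {xs = x ∷ xs} f≤g (here refl) fy<gy = +-mono-<-≤ fy<gy (sum-mono f≤g xs)
sum-strict {xs = x ∷ xs} f≤g (there y∈xs) fy<gy = +-mono-≤-< (f≤g x) (sum-strict f≤g y∈xs fy<gy)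

indicator : ∀ {n} → Family n → Fin n → Subset n → ℕ
indicator 𝓗 x S = if 𝓗 S ∧ lookup S x then 1 else 0

-- The number of members of 𝓗 containing x; standardHeight 𝓗 x is this
-- number minus one (definitionally).
memberCount : ∀ {n} → Family n → Fin n → ℕ
memberCount {n} 𝓗 x = sum (map (indicator 𝓗 x) (allSubsets n))

module _ {n : ℕ} {𝓗 : Family n} where

  indicator-member : ∀ {x S} → S ∈F 𝓗 → x ∈ S → indicator 𝓗 x S ≡ 1
  indicator-member {S = S} S∈𝓗 x∈S rewrite []=⇒lookup x∈S with 𝓗 S | S∈𝓗
  ... | true | _ = refl

  indicator-nonmember : ∀ {x S} → ¬ (S ∈F 𝓗 × x ∈ S) → indicator 𝓗 x S ≡ 0
  indicator-nonmember {x} {S} notBoth with 𝓗 S | lookup S x in x∈?S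
  ... | false | _     = refl
  ... | true  | false = refl
  ... | true  | true  = ⊥-elim (notBoth (tt , lookup⇒[]= x S x∈?S))

  indicator-mono : ∀ {x y} → (∀ M → M ∈F 𝓗 → x ∈ M → y ∈ M) →
                   ∀ S → indicator 𝓗 x S ≤ indicator 𝓗 y S
  indicator-mono {x} {y} x⇒y S with T? (𝓗 S) ×-dec (x ∈? S)
  ... | yes (S∈𝓗 , x∈S) = ≤-reflexive (trans (indicator-member S∈𝓗 x∈S)
                                        (sym (indicator-member S∈𝓗 (x⇒y S S∈𝓗 x∈S))))
  ... | no ¬both = subst (_≤ indicator 𝓗 y S) (sym (indicator-nonmember ¬both)) z≤n

  memberCount-mono : ∀ {x y} → (∀ M → M ∈F 𝓗 → x ∈ M → y ∈ M) →
                     memberCount 𝓗 x ≤ memberCount 𝓗 y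
  memberCount-mono x⇒y = sum-mono (indicator-mono x⇒y) (allSubsets n)

  memberCount-strict : ∀ {x y G} → (∀ M → M ∈F 𝓗 → x ∈ M → y ∈ M) →
                       G ∈F 𝓗 → y ∈ G → x ∉ G →
                       memberCount 𝓗 x < memberCount 𝓗 y
  memberCount-strict {x} {y} {G} x⇒y G∈𝓗 y∈G x∉G =
    sum-strict (indicator-mono x⇒y) (allSubsets-complete G) indicator-jumps
    where
    indicator-jumps : indicator 𝓗 x G < indicator 𝓗 y G
    indicator-jumps rewrite indicator-nonmember {x} {G} (x∉G ∘ proj₂)
                          | indicator-member G∈𝓗 y∈G = s≤s z≤n

module StandardHeightOrder {a ℓ₁ ℓ₂ : Level} (O : StrictTotalOrder a ℓ₁ ℓ₂)
    (ι : ℤ → StrictTotalOrder.Carrier O)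
    (ι-mono : ∀ {i j} → i <ℤ j → StrictTotalOrder._<_ O (ι i) (ι j)) where

  open StrictTotalOrder O using (irrefl; asym; module Eq) renaming (_<_ to _<ᴼ_)

  ι-reflects : ∀ {i j} → ι i <ᴼ ι j → i <ℤ j
  ι-reflects {i} {j} ιi<ιj with ℤP.<-cmp i j
  ... | tri< i<j _ _ = i<j
  ... | tri≈ _ refl _ = ⊥-elim (irrefl Eq.refl ιi<ιj)
  ... | tri> _ _ j<i = ⊥-elim (asym ιi<ιj (ι-mono j<i))

  module _ {n : ℕ} (𝓗 : Family n) where

    height : Fin n → StrictTotalOrder.Carrier O
    height = ι ∘ standardHeight 𝓗

    height-< : ∀ {x y} → memberCount 𝓗 x < memberCount 𝓗 y → height x <ᴼ height y
    height-< cx<cy = ι-mono (ℤP.+-monoˡ-< (- + 1) (+<+ cx<cy))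

    height-<⁻ : ∀ {x y} → height x <ᴼ height y → memberCount 𝓗 x < memberCount 𝓗 y
    height-<⁻ hx<hy = ≰⇒> λ cy≤cx →
      ℤP.<⇒≱ (ι-reflects hx<hy) (ℤP.+-monoˡ-≤ (- + 1) (+≤+ cy≤cx))

module ConnectiveDomain {n : ℕ} {𝓒 𝓚 : Family n}
    (𝓒⊆𝓚 : ∀ S → S ∈F 𝓒 → S ∈F 𝓚) (connective : Connective 𝓒 𝓚) where

  _≺_ : Subset n → Subset n → Set
  _≺_ = Defs._≺_ 𝓒 𝓚

  _δ_ : Subset n → Subset n → Set
  _δ_ = Defs._δ_ 𝓒 𝓚

  δ-Symmetric : Set
  δ-Symmetric = ∀ A B → A ∈F 𝓒 → B ∈F 𝓒 → Nonempty A → Nonempty B → A δ B → B δ A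

  _↝_ : Subset n → Fin n → Set
  A ↝ u = ∃ λ K → A ≺ K × u ∈ K × u ∉ A

  ReachesInto : Subset n → Subset n → Set
  ReachesInto A B = ∃ λ u → A ↝ u × u ∈ B

  coverBelow : ∀ {A K} → A ∈F 𝓚 → K ∈F 𝓚 → A ⊂ K → ∃ λ K′ → A ≺ K′ × K′ ⊆ K
  coverBelow {A} {K} A∈𝓚 K∈𝓚 A⊂K
    with minimiser (λ M → T? (𝓚 M) ×-dec (A ⊂? M) ×-dec (M ⊆? K)) ∣_∣
                   (allSubsets n) allSubsets-complete (K , K∈𝓚 , A⊂K , λ x∈K → x∈K)
  ... | K′ , (K′∈𝓚 , A⊂K′ , K′⊆K) , smallest =
    K′ , (A∈𝓚 , K′∈𝓚 , A⊂K′ , nothing-between) , K′⊆K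
    where
    nothing-between : ∀ M → M ∈F 𝓚 → ¬ (A ⊂ M × M ⊂ K′)
    nothing-between M M∈𝓚 (A⊂M , M⊂K′) =
      <⇒≱ (p⊂q⇒∣p∣<∣q∣ M⊂K′) (smallest M (M∈𝓚 , A⊂M , ⊆-trans (proj₁ M⊂K′) K′⊆K))

  connectiveEscape : ∀ {A B} → A ∈F 𝓒 → B ∈F 𝓒 → Nonempty (A ∩ B) → B ⊈ A →
                     ReachesInto A B
  connectiveEscape {A} {B} A∈𝓒 B∈𝓒 meet B⊈A
    with connective A B A∈𝓒 B∈𝓒 meet B⊈A
  ... | K , K∈𝓚 , A⊂K , K⊆A∪B with coverBelow (𝓒⊆𝓚 A A∈𝓒) K∈𝓚 A⊂K
  ... | K′ , A≺K′@(_ , _ , (_ , u , u∈K′ , u∉A) , _) , K′⊆K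
    with x∈p∪q⁻ A B (K⊆A∪B (K′⊆K u∈K′))
  ... | inj₁ u∈A = ⊥-elim (u∉A u∈A)
  ... | inj₂ u∈B = u , (K′ , A≺K′ , u∈K′ , u∉A) , u∈B

  δ-reaches : ∀ {A B} → (∀ {x} → x ∈ A → x ∉ B) → A δ B → ReachesInto A B
  δ-reaches {B = B} disjoint (K , _ , A⪯K , w , w∈K∩B) with x∈p∩q⁻ K B w∈K∩B | A⪯K
  ... | w∈K , w∈B | inj₂ refl = ⊥-elim (disjoint w∈K w∈B)
  ... | w∈K , w∈B | inj₁ A≺K  = w , (K , A≺K , w∈K , λ w∈A → disjoint w∈A w∈B) , w∈B

  reaches-δ : ∀ {A B} → ReachesInto A B → A δ B
  reaches-δ (u , (K , A≺K@(_ , K∈𝓚 , _) , u∈K , _) , u∈B) =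
    K , K∈𝓚 , inj₁ A≺K , u , x∈p∩q⁺ (u∈K , u∈B)

  module Islands {a ℓ₁ ℓ₂ : Level} (O : StrictTotalOrder a ℓ₁ ℓ₂)
      (h : Fin n → StrictTotalOrder.Carrier O) where

    open StrictTotalOrder O using (asym) renaming (_<_ to _<ᴼ_)

    Island : Subset n → Set ℓ₂
    Island = IsIsland 𝓒 𝓚 O h

    island-below : ∀ {S u v} → Island S → S ↝ u → v ∈ S → h u <ᴼ h v
    island-below (_ , _ , lower) (K , S≺K , u∈K , u∉S) v∈S = lower K S≺K _ u∈K u∉S _ v∈S

    -- Two islands cannot reach into each other: that would give h u < h w < h u.
    no-mutual-reach : ∀ {A B} → Island A → Island B →
                      ReachesInto A B → ReachesInto B A → ⊥
    no-mutual-reach IA IB (u , A↝u , u∈B) (w , B↝w , w∈A) =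
      asym (island-below IA A↝u w∈A) (island-below IB B↝w u∈B)

    -- Incomparable islands are disjoint: a common point lets each escape into the other.
    islands-disjoint : ∀ {A B} → Island A → Island B → A ⊈ B → B ⊈ A →
                       ∀ {x} → x ∈ A → x ∉ B
    islands-disjoint IA@(_ , A∈𝓒 , _) IB@(_ , B∈𝓒 , _) A⊈B B⊈A x∈A x∈B =
      no-mutual-reach IA IB
        (connectiveEscape A∈𝓒 B∈𝓒 (_ , x∈p∩q⁺ (x∈A , x∈B)) B⊈A)
        (connectiveEscape B∈𝓒 A∈𝓒 (_ , x∈p∩q⁺ (x∈B , x∈A)) A⊈B)

    -- If δ is symmetric, incomparable islands are not δ-related: δ-witnesses
    -- in both directions between disjoint islands are mutual reaches.
    islands-not-δ : δ-Symmetric → ∀ {A B} → Island A → Island B → A ⊈ B → B ⊈ A → ¬ (A δ B)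
    islands-not-δ δ-sym IA@(A≠∅ , A∈𝓒 , _) IB@(B≠∅ , B∈𝓒 , _) A⊈B B⊈A AδB =
      no-mutual-reach IA IB
        (δ-reaches (islands-disjoint IA IB A⊈B B⊈A) AδB)
        (δ-reaches (λ x∈B x∈A → islands-disjoint IA IB A⊈B B⊈A x∈A x∈B)
                   (δ-sym _ _ A∈𝓒 B∈𝓒 A≠∅ B≠∅ AδB))

    islands-distant : δ-Symmetric → ∀ {A B} → Island A → Island B → A ⊈ B → B ⊈ A →
                      Distant 𝓒 𝓚 A B
    islands-distant δ-sym IA IB A⊈B B⊈A =
      islands-not-δ δ-sym IA IB A⊈B B⊈A , islands-not-δ δ-sym IB IA B⊈A A⊈B

  module DistantFamily (𝓗 : Family n)
      (𝓗-members : ∀ S → S ∈F 𝓗 → S ∈F 𝓒 × Nonempty S) (U∈𝓗 : Uset ∈F 𝓗)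
      (distant : ∀ A B → A ∈F 𝓗 → B ∈F 𝓗 → A ⊈ B → B ⊈ A → Distant 𝓒 𝓚 A B) where

    𝓗⊆𝓒 : ∀ {S} → S ∈F 𝓗 → S ∈F 𝓒
    𝓗⊆𝓒 {S} S∈𝓗 = proj₁ (𝓗-members S S∈𝓗)

    -- Members that meet are comparable (a common point is a δ-witness with K = A).
    laminar : ∀ {A B x} → A ∈F 𝓗 → B ∈F 𝓗 → x ∈ A → x ∈ B → A ⊆ B ⊎ B ⊆ A
    laminar {A} {B} {x} A∈𝓗 B∈𝓗 x∈A x∈B with A ⊆? B | B ⊆? A
    ... | yes A⊆B | _       = inj₁ A⊆B
    ... | no _    | yes B⊆A = inj₂ B⊆A
    ... | no A⊈B  | no B⊈A  = ⊥-elim (proj₁ (distant A B A∈𝓗 B∈𝓗 A⊈B B⊈A)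
        (A , 𝓒⊆𝓚 A (𝓗⊆𝓒 A∈𝓗) , inj₂ refl , x , x∈p∩q⁺ (x∈A , x∈B)))

    -- Every point v lies in a least member of 𝓗: take one of least size and use laminarity.
    leastMember : ∀ v → ∃ λ G → G ∈F 𝓗 × v ∈ G × (∀ M → M ∈F 𝓗 → v ∈ M → G ⊆ M)
    leastMember v
      with minimiser (λ M → T? (𝓗 M) ×-dec (v ∈? M)) ∣_∣
                     (allSubsets n) allSubsets-complete (Uset , U∈𝓗 , ∈⊤)
    ... | G , (G∈𝓗 , v∈G) , smallest = G , G∈𝓗 , v∈G , below
      where
      below : ∀ M → M ∈F 𝓗 → v ∈ M → G ⊆ M
      below M M∈𝓗 v∈M {x} x∈G with laminar G∈𝓗 M∈𝓗 v∈G v∈M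
      ... | inj₁ G⊆M = G⊆M x∈G
      ... | inj₂ M⊆G = decidable-stable (x ∈? M) λ x∉M →
        <⇒≱ (p⊂q⇒∣p∣<∣q∣ (M⊆G , x , x∈G , x∉M)) (smallest M (M∈𝓗 , v∈M))

    -- A member A with A ↝ u lies inside every member containing u: otherwise
    -- the two would be incomparable, yet A reaches into the other.
    reach-inside : ∀ {A M u} → A ∈F 𝓗 → A ↝ u → M ∈F 𝓗 → u ∈ M → A ⊆ M
    reach-inside {A} {M} A∈𝓗 A↝u@(_ , _ , _ , u∉A) M∈𝓗 u∈M with A ⊆? M | M ⊆? A
    ... | yes A⊆M | _       = A⊆M
    ... | no _    | yes M⊆A = ⊥-elim (u∉A (M⊆A u∈M))
    ... | no A⊈M  | no M⊈A  =
      ⊥-elim (proj₁ (distant A M A∈𝓗 M∈𝓗 A⊈M M⊈A) (reaches-δ (_ , A↝u , u∈M)))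

    count-drops : ∀ {A u v} → A ∈F 𝓗 → A ↝ u → v ∈ A → memberCount 𝓗 u < memberCount 𝓗 v
    count-drops A∈𝓗 A↝u@(_ , _ , _ , u∉A) v∈A =
      memberCount-strict (λ M M∈𝓗 u∈M → reach-inside A∈𝓗 A↝u M∈𝓗 u∈M v∈A) A∈𝓗 v∈A u∉A

    module _ {a ℓ₁ ℓ₂ : Level} (O : StrictTotalOrder a ℓ₁ ℓ₂)
        (ι : ℤ → StrictTotalOrder.Carrier O)
        (ι-mono : ∀ {i j} → i <ℤ j → StrictTotalOrder._<_ O (ι i) (ι j)) where

      open StandardHeightOrder O ι ι-mono
      open Islands O (height 𝓗)

      members-are-islands : ∀ {S} → S ∈F 𝓗 → Island S
      members-are-islands {S} S∈𝓗 = proj₂ (𝓗-members S S∈𝓗) , 𝓗⊆𝓒 S∈𝓗 ,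
        λ K S≺K u u∈K u∉S v v∈S → height-< 𝓗 (count-drops S∈𝓗 (K , S≺K , u∈K , u∉S) v∈S)

      island-cannot-reach : ∀ {S B v} → Island S → v ∈ S →
        (∀ x → x ∈ B → memberCount 𝓗 v ≤ memberCount 𝓗 x) → ¬ ReachesInto S B
      island-cannot-reach IS v∈S v-below (u , S↝u , u∈B) =
        <⇒≱ (height-<⁻ 𝓗 (island-below IS S↝u v∈S)) (v-below u u∈B)

      member-cannot-reach : ∀ {G B v} → G ∈F 𝓗 → v ∈ G →
        (∀ x → x ∈ B → memberCount 𝓗 v ≤ memberCount 𝓗 x) → ¬ ReachesInto G B
      member-cannot-reach G∈𝓗 v∈G v-below (w , G↝w , w∈B) =
        <⇒≱ (count-drops G∈𝓗 G↝w v∈G) (v-below w w∈B)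

      -- For an island S take v ∈ S of least count and the least member G ∋ v,
      -- whose points all have count ≥ that of v.  If S and G differ, one of
      -- them escapes into the other, contradicting one of the two lemmas above.
      islands-are-members : ∀ {S} → Island S → S ∈F 𝓗
      islands-are-members {S} IS@(S≠∅ , S∈𝓒 , _)
        with minimiser (_∈? S) (memberCount 𝓗) (allFin n) ∈-allFin S≠∅
      ... | v , v∈S , v-lowest with leastMember v
      ... | G , G∈𝓗 , v∈G , G-least with G ⊆? S | S ⊆? G
      ... | yes G⊆S | yes S⊆G = subst (_∈F 𝓗) (⊆-antisym G⊆S S⊆G) G∈𝓗
      ... | no G⊈S  | _       = ⊥-elim (island-cannot-reach IS v∈S G-above-v
          (connectiveEscape S∈𝓒 (𝓗⊆𝓒 G∈𝓗) (v , x∈p∩q⁺ (v∈S , v∈G)) G⊈S))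
        where
        G-above-v : ∀ x → x ∈ G → memberCount 𝓗 v ≤ memberCount 𝓗 x
        G-above-v x x∈G = memberCount-mono λ M M∈𝓗 v∈M → G-least M M∈𝓗 v∈M x∈G
      ... | yes _   | no S⊈G  = ⊥-elim (member-cannot-reach G∈𝓗 v∈G v-lowest
          (connectiveEscape (𝓗⊆𝓒 G∈𝓗) S∈𝓒 (v , x∈p∩q⁺ (v∈G , v∈S)) S⊈G))

corollary5p9 : ∀ {a ℓ₁ ℓ₂ : Level} (O : StrictTotalOrder a ℓ₁ ℓ₂)
    (ι : ℤ → StrictTotalOrder.Carrier O)
    → (∀ {i j} → i <ℤ j → StrictTotalOrder._<_ O (ι i) (ι j))
    → (n : ℕ) → 0 < n
    → (𝓒 𝓚 𝓗 : Family n)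
    → IsProximityDomain 𝓒 𝓚
    → (∀ S → S ∈F 𝓗 → S ∈F 𝓒 × Nonempty S)
    → Uset ∈F 𝓗
    → ((IsSystemOfIslands 𝓒 𝓚 O 𝓗 → IsDistantFamily 𝓒 𝓚 𝓗)
       × (IsDistantFamily 𝓒 𝓚 𝓗 → IsSystemOfIslands 𝓒 𝓚 O 𝓗))
      × (IsDistantFamily 𝓒 𝓚 𝓗
         → IsSystemOfIslandsFor 𝓒 𝓚 O (ι ∘ standardHeight 𝓗) 𝓗)
corollary5p9 O ι ι-mono _ _ 𝓒 𝓚 𝓗 ((𝓒⊆𝓚 , _) , connective , δ-symmetric) 𝓗-members U∈𝓗 =
  (islands⇒distant , λ D → ι ∘ standardHeight 𝓗 , distant⇒standardIslands D) ,
  distant⇒standardIslands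
  where
  open ConnectiveDomain 𝓒⊆𝓚 connective

  δ-sym : δ-Symmetric
  δ-sym A B A∈𝓒 B∈𝓒 A≠∅ B≠∅ = proj₁ (δ-symmetric A B A∈𝓒 B∈𝓒 A≠∅ B≠∅)

  islands⇒distant : IsSystemOfIslands 𝓒 𝓚 O 𝓗 → IsDistantFamily 𝓒 𝓚 𝓗
  islands⇒distant (h , system) =
    (λ S S∈𝓗 → proj₁ (𝓗-members S S∈𝓗)) , (Uset , U∈𝓗) ,
    λ A B A∈𝓗 B∈𝓗 → Islands.islands-distant O h δ-sym
                      (proj₁ (system A) A∈𝓗) (proj₁ (system B) B∈𝓗)

  distant⇒standardIslands : IsDistantFamily 𝓒 𝓚 𝓗 →
                            IsSystemOfIslandsFor 𝓒 𝓚 O (ι ∘ standardHeight 𝓗) 𝓗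
  distant⇒standardIslands (_ , _ , distant) S =
    members-are-islands O ι ι-mono , islands-are-members O ι ι-mono
    where open DistantFamily 𝓗 𝓗-members U∈𝓗 distant
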